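{- Let $p\ge2$ and let $m_1,\dots,m_p$ be positive integers. Two points $P_1=(x_1,\dots,x_p)$ and $P_2=(y_1,\dots,y_p)$ of $\mathcal{S}^p$ lie in the same orbit if and only if $I(P_1)=I(P_2)$.
   Context: $\mathcal{S}^p=\{(x_1,\dots,x_p)\in\mathbb{Z}^p: 0\le x_i\le m_i\}$. A diagonal move takes $P\in\mathcal{S}^p$ to $Q\in\mathcal{S}^p$ with $Q-P\in\{\pm1\}^p$ (along a main diagonal of a unit cube); two points lie in the same orbit if one can be reached from the other by a finite sequence of diagonal moves (equivalently, orbits of the group generated by the maps $(x_1,\dots,x_p)\mapsto(\varphi_{m_1}(x_1\pm1),\dots,\varphi_{m_p}(x_p\pm1))$ with independent signs, where $\varphi_m(u)=\min_{n\in\mathbb{Z}}|u-2nm|$). For an integer $a$, $[a]_2\in\{0,1\}$ denotes its residue mod $2$. The index of $P=(x_1,\dots,x_p)$ is $I(P)=([x_1+x_2]_2,[x_1+x_3]_2,\dots,[x_1+x_p]_2)$. -}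

module Defs where

open import Data.Nat using (ℕ; zero; suc; _+_; _≤_; pred)
open import Data.Nat.DivMod using (_%_)
open import Data.Fin using (Fin; zero; suc)
open import Data.Vec using (Vec; tabulate)
open import Data.Product using (Σ; proj₁)
open import Data.Sum using (_⊎_)
open import Relation.Binary.PropositionalEquality using (_≡_)
open import Relation.Binary.Construct.Closure.ReflexiveTransitive using (Star)

-- The box S^p = { x ∈ ℤ^p : 0 ≤ x_i ≤ m_i }, coordinates as naturals.
Point : {p : ℕ} → (Fin p → ℕ) → Set
Point {p} m = Σ (Fin p → ℕ) (λ x → ∀ i → x i ≤ m i)

DiagMove : {p : ℕ} {m : Fin p → ℕ} → Point m → Point m → Set
DiagMove P Q = ∀ i → (proj₁ Q i ≡ suc (proj₁ P i)) ⊎ (proj₁ P i ≡ suc (proj₁ Q i))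

SameOrbit : {p : ℕ} {m : Fin p → ℕ} → Point m → Point m → Set
SameOrbit = Star DiagMove

index : {p : ℕ} → (Fin p → ℕ) → Vec ℕ (pred p)
index {zero} x = tabulate (λ ())
index {suc q} x = tabulate (λ j → (x zero + x (suc j)) % 2)

-- A diagonal move changes every coordinate by ±1, hence flips the parity of every
-- coordinate and preserves the parity of each x₁ + xⱼ. Conversely, if I(P) = I(Q) then
-- all xᵢ + yᵢ have one common parity. Since mᵢ ≥ 1, inside [0, mᵢ] one can walk from
-- xᵢ to yᵢ in exactly T unit steps whenever T ≥ |xᵢ − yᵢ| and T ≡ xᵢ + yᵢ (mod 2):
-- head for yᵢ, then bounce off a neighbour. Choosing one such T for all coordinates
-- and running the p walks in parallel gives a sequence of diagonal moves from P to Q.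
module Submission where

open import Defs
open import Data.Nat using (ℕ; zero; suc; _+_; _⊔_; _≤_; _<_; s≤s; parity)
open import Data.Nat.Properties
  using (≤-trans; ≤-antisym; ≤-pred; <-cmp; n≤1+n; m≤n+m; m≤m⊔n; m≤n⊔m;
         m≤n⇒m≤n+o; m≤n⇒m≤o+n; +-suc)
open import Data.Nat.DivMod using (_%_)
open import Data.Parity.Base as ℙ using (0ℙ; 1ℙ; _⁻¹)
open import Data.Parity.Properties
  using (⁻¹-involutive; ⁻¹-selfInverse; ⁻¹-injective; p+p≡0ℙ; p+p⁻¹≡1ℙ; p⁻¹+p≡1ℙ;
         suc-homo-⁻¹; +-homo-+)
open import Data.Fin using (Fin; zero; suc)
open import Data.Vec using (lookup)
open import Data.Vec.Properties using (tabulate-cong; lookup∘tabulate)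
open import Data.Product using (∃-syntax; _,_; proj₁; proj₂)
open import Data.Sum using (_⊎_; inj₁; inj₂)
open import Function.Bundles using (_⇔_; mk⇔)
open import Relation.Binary using (tri<; tri≈; tri>)
open import Relation.Binary.PropositionalEquality
  using (_≡_; refl; sym; trans; cong; cong₂; subst; module ≡-Reasoning)
open import Relation.Binary.Construct.Closure.ReflexiveTransitive using (ε; _◅_; fold)

open ≡-Reasoning

parity-%2 : ∀ n → parity (n % 2) ≡ parity n
parity-%2 zero          = refl
parity-%2 (suc zero)    = refl
parity-%2 (suc (suc n)) = parity-%2 n

%2≡⇒parity≡ : ∀ m n → m % 2 ≡ n % 2 → parity m ≡ parity n
%2≡⇒parity≡ m n eq = trans (sym (parity-%2 m)) (trans (cong parity eq) (parity-%2 n))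

parity≡⇒%2≡ : ∀ m n → parity m ≡ parity n → m % 2 ≡ n % 2
parity≡⇒%2≡ zero          zero          _  = refl
parity≡⇒%2≡ zero          (suc zero)    ()
parity≡⇒%2≡ zero          (suc (suc n)) eq = parity≡⇒%2≡ zero n eq
parity≡⇒%2≡ (suc zero)    zero          ()
parity≡⇒%2≡ (suc zero)    (suc zero)    _  = refl
parity≡⇒%2≡ (suc zero)    (suc (suc n)) eq = parity≡⇒%2≡ 1 n eq
parity≡⇒%2≡ (suc (suc m)) n             eq = parity≡⇒%2≡ m n eq

parity-suc-injective : ∀ {m n} → parity (suc m) ≡ parity (suc n) → parity m ≡ parity n
parity-suc-injective {m} {n} eq =
  trans (sym (suc-homo-⁻¹ m)) (trans (cong _⁻¹ eq) (suc-homo-⁻¹ n))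

parity-double : ∀ n → parity (n + n) ≡ 0ℙ
parity-double n = trans (+-homo-+ n n) (p+p≡0ℙ (parity n))

⁻¹-+-⁻¹ : ∀ p q → p ⁻¹ ℙ.+ q ⁻¹ ≡ p ℙ.+ q
⁻¹-+-⁻¹ 0ℙ q = ⁻¹-involutive q
⁻¹-+-⁻¹ 1ℙ q = refl

+-interchange : ∀ p q r s → p ℙ.+ q ≡ r ℙ.+ s → q ℙ.+ s ≡ p ℙ.+ r
+-interchange 0ℙ q 0ℙ s eq = trans (cong (q ℙ.+_) (sym eq)) (p+p≡0ℙ q)
+-interchange 0ℙ q 1ℙ s eq = trans (cong (ℙ._+ s) eq) (p⁻¹+p≡1ℙ s)
+-interchange 1ℙ q 0ℙ s eq = trans (cong (q ℙ.+_) (sym eq)) (p+p⁻¹≡1ℙ q)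
+-interchange 1ℙ q 1ℙ s eq = trans (cong (q ℙ.+_) (sym (⁻¹-injective eq))) (p+p≡0ℙ q)

Adjacent : ℕ → ℕ → Set
Adjacent a b = (b ≡ suc a) ⊎ (a ≡ suc b)

parity-adjacent : ∀ {a b} → Adjacent a b → parity b ≡ parity a ⁻¹
parity-adjacent {a}     (inj₁ refl) = sym (⁻¹-selfInverse (suc-homo-⁻¹ a))
parity-adjacent {b = b} (inj₂ refl) = sym (suc-homo-⁻¹ b)

parity-+-adjacent : ∀ {a a′ b b′} → Adjacent a a′ → Adjacent b b′ →
                    parity (a + b) ≡ parity (a′ + b′)
parity-+-adjacent {a} {a′} {b} {b′} a~a′ b~b′ = begin
  parity (a + b)                ≡⟨ +-homo-+ a b ⟩
  parity a ℙ.+ parity b         ≡⟨ ⁻¹-+-⁻¹ (parity a) (parity b) ⟨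
  parity a ⁻¹ ℙ.+ parity b ⁻¹   ≡⟨ cong₂ ℙ._+_ (parity-adjacent a~a′) (parity-adjacent b~b′) ⟨
  parity a′ ℙ.+ parity b′       ≡⟨ +-homo-+ a′ b′ ⟨
  parity (a′ + b′)              ∎

data Walk (m : ℕ) : ℕ → ℕ → ℕ → Set where
  []   : ∀ {a} → Walk m 0 a a
  step : ∀ {T a b c} → Adjacent a b → b ≤ m → Walk m T b c → Walk m (suc T) a c

module _ {m T a c : ℕ} where

  second : Walk m (suc T) a c → ℕ
  second (step {b = b} _ _ _) = b

  second-adjacent : (w : Walk m (suc T) a c) → Adjacent a (second w)
  second-adjacent (step a~b _ _) = a~b

  second-≤ : (w : Walk m (suc T) a c) → second w ≤ m
  second-≤ (step _ b≤m _) = b≤m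

  tail : (w : Walk m (suc T) a c) → Walk m T (second w) c
  tail (step _ _ w) = w

module _ {m : ℕ} (m>0 : 0 < m) where

  linger : ∀ {T a} → a ≤ m → Walk m T a a → Walk m (2 + T) a a
  linger {a = zero}  a≤m w = step (inj₁ refl) m>0 (step (inj₂ refl) a≤m w)
  linger {a = suc a} a≤m w = step (inj₂ refl) (≤-trans (n≤1+n a) a≤m) (step (inj₁ refl) a≤m w)

  closedWalk : ∀ T {a} → a ≤ m → parity T ≡ 0ℙ → Walk m T a a
  closedWalk zero          a≤m _   = []
  closedWalk (suc zero)    a≤m ()
  closedWalk (suc (suc T)) a≤m eq = linger a≤m (closedWalk T a≤m eq)

  walk : ∀ T {a b} → a ≤ m → b ≤ m → a ≤ T + b → b ≤ T + a →
         parity T ≡ parity (a + b) → Walk m T a b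
  walk zero a≤m b≤m a≤b b≤a _ = subst (Walk m 0 _) (≤-antisym a≤b b≤a) []
  walk (suc T) {a} {b} a≤m b≤m a≤ b≤ eq with <-cmp a b
  ... | tri< a<b _ _ =
    step (inj₁ refl) (≤-trans a<b b≤m)
      (walk T (≤-trans a<b b≤m) b≤m (≤-trans a<b (m≤n+m b T))
         (subst (b ≤_) (sym (+-suc T a)) b≤) (parity-suc-injective {T} {suc a + b} eq))
  ... | tri> _ _ (s≤s {n = a′} b≤a′) =
    step (inj₂ refl) (≤-trans (n≤1+n a′) a≤m)
      (walk T (≤-trans (n≤1+n a′) a≤m) b≤m (≤-pred a≤) (≤-trans b≤a′ (m≤n+m a′ T))
         (parity-suc-injective {T} {a′ + b} eq))
  ... | tri≈ _ refl _ = closedWalk (suc T) a≤m (trans eq (parity-double a))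

∃-upperBound : ∀ {p} (f : Fin p → ℕ) → ∃[ M ] (∀ i → f i ≤ M)
∃-upperBound {zero}  f = 0 , λ ()
∃-upperBound {suc p} f with ∃-upperBound (λ i → f (suc i))
... | M , f≤M = f zero ⊔ M , λ where
  zero    → m≤m⊔n (f zero) M
  (suc i) → ≤-trans (f≤M i) (m≤n⊔m (f zero) M)

module _ {p : ℕ} {m : Fin p → ℕ} where

  -- Walks of positive length, so that the last move lands on Q itself: without
  -- function extensionality pointwise equal points need not be equal.
  walks⇒sameOrbit : ∀ T (P Q : Point m) →
                    (∀ i → Walk (m i) (suc T) (proj₁ P i) (proj₁ Q i)) → SameOrbit P Q
  walks⇒sameOrbit zero    P Q ws = (λ i → single (ws i)) ◅ ε
    where
    single : ∀ {k a b} → Walk k 1 a b → Adjacent a b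
    single (step a~b _ []) = a~b
  walks⇒sameOrbit (suc T) P Q ws =
    (λ i → second-adjacent (ws i)) ◅ walks⇒sameOrbit T R Q (λ i → tail (ws i))
    where
    R : Point m
    R = (λ i → second (ws i)) , (λ i → second-≤ (ws i))

module _ {q : ℕ} {m : Fin (suc q) → ℕ} where

  index-invariant : ∀ {P Q : Point m} → DiagMove P Q → index (proj₁ P) ≡ index (proj₁ Q)
  index-invariant {x , _} {y , _} move = tabulate-cong λ j →
    parity≡⇒%2≡ (x zero + x (suc j)) (y zero + y (suc j))
                (parity-+-adjacent (move zero) (move (suc j)))

  sameOrbit⇒index≡ : ∀ {P Q : Point m} → SameOrbit P Q → index (proj₁ P) ≡ index (proj₁ Q)
  sameOrbit⇒index≡ = fold (λ P Q → index (proj₁ P) ≡ index (proj₁ Q))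
                          (λ {P} {Q} move eq → trans (index-invariant {P} {Q} move) eq) refl

lookup-index : ∀ {q} (x : Fin (suc q) → ℕ) j → lookup (index x) j ≡ (x zero + x (suc j)) % 2
lookup-index x j = lookup∘tabulate (λ j → (x zero + x (suc j)) % 2) j

index≡⇒parity≡ : ∀ {q} (x y : Fin (suc q) → ℕ) → index x ≡ index y →
                 ∀ i → parity (x i + y i) ≡ parity (x zero + y zero)
index≡⇒parity≡ x y eq zero    = refl
index≡⇒parity≡ x y eq (suc j) = begin
  parity (xⱼ + yⱼ)         ≡⟨ +-homo-+ xⱼ yⱼ ⟩
  parity xⱼ ℙ.+ parity yⱼ  ≡⟨ +-interchange (parity x₀) (parity xⱼ) (parity y₀) (parity yⱼ)
                                             index₀ⱼ ⟩
  parity x₀ ℙ.+ parity y₀  ≡⟨ +-homo-+ x₀ y₀ ⟨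
  parity (x₀ + y₀)         ∎
  where
  x₀ = x zero
  y₀ = y zero
  xⱼ = x (suc j)
  yⱼ = y (suc j)
  index₀ⱼ : parity x₀ ℙ.+ parity xⱼ ≡ parity y₀ ℙ.+ parity yⱼ
  index₀ⱼ = begin
    parity x₀ ℙ.+ parity xⱼ  ≡⟨ +-homo-+ x₀ xⱼ ⟨
    parity (x₀ + xⱼ)         ≡⟨ %2≡⇒parity≡ (x₀ + xⱼ) (y₀ + yⱼ) (begin
      (x₀ + xⱼ) % 2            ≡⟨ lookup-index x j ⟨
      lookup (index x) j       ≡⟨ cong (λ v → lookup v j) eq ⟩
      lookup (index y) j       ≡⟨ lookup-index y j ⟩
      (y₀ + yⱼ) % 2            ∎) ⟩
    parity (y₀ + yⱼ)         ≡⟨ +-homo-+ y₀ yⱼ ⟩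
    parity y₀ ℙ.+ parity yⱼ  ∎

index≡⇒sameOrbit : ∀ {q} {m : Fin (suc q) → ℕ} → (∀ i → 0 < m i) →
                   (P Q : Point m) → index (proj₁ P) ≡ index (proj₁ Q) → SameOrbit P Q
index≡⇒sameOrbit {m = m} m>0 P@(x , x≤m) Q@(y , y≤m) eq =
  walks⇒sameOrbit (suc T) P Q λ i →
    walk (m>0 i) (2 + T) (x≤m i) (y≤m i)
      (m≤n⇒m≤n+o (y i) (≤-trans (x≤m i) (m≤2+T i)))
      (m≤n⇒m≤n+o (x i) (≤-trans (y≤m i) (m≤2+T i)))
      (trans parity-T (sym (index≡⇒parity≡ x y eq i)))
  where
  -- 2 + T bounds every mᵢ and has the parity of every xᵢ + yᵢ.
  M = proj₁ (∃-upperBound m)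
  T = M + M + (x zero + y zero)
  m≤2+T : ∀ i → m i ≤ 2 + T
  m≤2+T i = m≤n⇒m≤o+n 2 (m≤n⇒m≤n+o (x zero + y zero)
            (m≤n⇒m≤n+o M (proj₂ (∃-upperBound m) i)))
  parity-T : parity T ≡ parity (x zero + y zero)
  parity-T = trans (+-homo-+ (M + M) (x zero + y zero))
                   (cong (ℙ._+ parity (x zero + y zero)) (parity-double M))

theorem4p17 : (p : ℕ) → 2 ≤ p → (m : Fin p → ℕ) → (∀ i → 0 < m i) →
    (P₁ P₂ : Point m) →
    SameOrbit P₁ P₂ ⇔ (index (proj₁ P₁) ≡ index (proj₁ P₂))
theorem4p17 (suc q) _ m m>0 P₁ P₂ = mk⇔ sameOrbit⇒index≡ (index≡⇒sameOrbit m>0 P₁ P₂)
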